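{- Exhaustive application of the internal rules CreateInstance, UpdateWatched, FactorizeWatched, DetectPropLiteral and Conflict of the calculus TWFO, starting from any start state, terminates.
   Context: Setting: first-order logic without equality. Clauses are finite multisets of literals (read as disjunctions, variables implicitly universally quantified); different clauses need not be variable-disjoint. $\operatorname{comp}(L)$ is the complement of $L$. A trail $M$ is a finite consistent sequence of ground literals. W.r.t. $M$, a literal $L$ is true if $L\in M$, false if $\operatorname{comp}(L)\in M$, assigned if true or false, unassigned otherwise (non-ground literals are always unassigned). $M\models\neg C$ means every literal of $C$ is false w.r.t. $M$. A substitution $\sigma$ is a minimal grounding substitution for an expression $Z$ if $Z\sigma$ is ground and $\operatorname{dom}(\sigma)=\operatorname{vars}(Z)$. mgu denotes a most general unifier, assumed idempotent and introducing no fresh variables. For literals $L_j$ of $C$, $L_j\sigma\in C\sigma$ denotes multiset membership. States: tuples $(M;O;F;D)$ where $M$ is a trail; $O$ is a set of triples $(C;L_1;L_2)$ with $C$ a clause (a "clause instance") and $L_1,L_2$ its two watched literals; a triple may carry the annotation $\top$, written $(C;L_1;L_2)^\top$, marking initial or added clauses; $F$ is a set of annotated literals $L^{C;K}$ with $C$ a clause and $K$ a literal of $M$ or $K=\top$; $D$ is a clause (a conflict) or $\top$. The associated clause set is $N=\{C\mid (C;L_1;L_2)^\top\in O\}$. A literal $L_j\sigma$ is fresh in $(C;L_1;L_2)$ if $L_j\sigma\in C\sigma$, $L_j\sigma\neq L_1\sigma$ and $L_j\sigma\neq L_2\sigma$. Start state for a clause set $N$ and a (possibly empty) trail $M$: $(M;O;F;\top)$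 with $O=\{(C;L_1;L_2)^\top\mid C\in N\}$ where $L_1,L_2\in C$ and $L_1\neq L_2$ iff $|C|>1$; $F$ consists of literals annotated with $\top$: it is assumed that all initially propagatable unit literals obtainable by factoring (i.e. $L^{C\tau;\top}$ with $C\in N$, $C\tau=L\lor\dots\lor L$) are in $F$ and no non-propagatable literal is in $F$. Internal rules (in each, $O\uplus\{(C;L_1;L_2)\}$ means the triple is in $O$; it is kept): CreateInstance: $(M;O\uplus\{(C;L_1;L_2)\};F;\top)\Rightarrow(M;O\cup\{(C;L_1;L_2),(C\sigma;L_j\sigma;L_k\sigma)\};F;\top)$ provided (i) $\operatorname{comp}(L_1\sigma)\in M$ for some minimal grounding substitution $\sigma$ (of $L_1$); (ii) $L_j\sigma\in C\sigma$; (iii) if not all literals of $C\sigma$ are equal then $L_k\sigma\neq L_j\sigma$; (iv) if possible $L_j\sigma\in M$, otherwise if possible $L_j\sigma$ unassigned, otherwise $M=M_1'\operatorname{comp}(L_j\sigma)M_1''$ and $\operatorname{comp}(L\sigma)\notin M_1''$ for all $L\sigma\in C\sigma$; (v) if $\operatorname{comp}(L_2\sigma)\notin M$ then $L_k=L_2$, else $L_k\sigma\in C\sigma$ and if possible $L_k\sigma\in M$, otherwise if possible $L_k\sigma$ unassigned, otherwise $M=M_2'\operatorname{comp}(L_k\sigma)M_2''$ and $\operatorname{comp}(L\sigma)\notin M_2''$ for all $L\sigma\in C\sigma\setminus\{L_j\sigma\}$; (vi) there are no $K_1\sigma,K_2\sigma\in C\sigma$ with $(C\sigma;K_1\sigma;K_2\sigma)\in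 O$. UpdateWatched: $(M;O\uplus\{(C;L_1;L_2)\};F;\top)\Rightarrow(M;O\cup\{(C;L_j;L_2)\};F;\top)$ provided $\operatorname{comp}(L_1)\in M$, $L_2\notin M$, and $L_j\in C$ is fresh with $L_j\in M$, or, if no such $L_j$ exists, $L_j$ is unassigned. FactorizeWatched: $(M;O\uplus\{(C;L_1;L_2)\};F;\top)\Rightarrow(M;O\cup\{(C;L_1;L_2),(C\sigma;L_j\sigma;L_k\sigma)\};F;\top)$ provided (i) $L_1\sigma=L_2\sigma$ for the mgu $\sigma$; (ii) $L_j\sigma\in C\sigma$ is fresh; (iii) $L_j\sigma\neq L_k\sigma$; (iv),(v),(vi) exactly as conditions (iv),(v),(vi) of CreateInstance. DetectPropLiteral: $(M;O\uplus\{(C;L_1;L_2)\};F;\top)\Rightarrow(M;O\cup\{(C;L_1;L_2)\};F\cup\{L_2^{C;K}\};\top)$ provided (i) $\operatorname{comp}(L_1)\in M$; (ii) $C=C_0\lor L_2\lor\dots\lor L_2$; (iii) $L_2$ unassigned; (iv) $M\models\neg C_0$; (v) $M=M'KM''$ with $\operatorname{comp}(K)\in C$ and $\operatorname{comp}(L)\notin M''$ for all $L\in C$; (vi) there is no $H^{D;K'}\in F$ with $H\tau=L_2$ for some substitution $\tau$ and $K'\in M'K$. Conflict: $(M;O\uplus\{(C;L_1;L_2)\};F;\top)\Rightarrow(M;O\cup\{(C;L_1;L_2)\};F;C)$ provided $\operatorname{comp}(L_1)\in M$, $\operatorname{comp}(L_2)\in M$ and $M\models\neg C$. -}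

module Defs where

open import Data.Nat using (ℕ; zero; suc; _<_)
open import Data.Bool using (Bool; true; false; not)
open import Data.Fin using (Fin)
open import Data.List using (List; []; _∷_; _++_; map; length; lookup; replicate)
open import Data.List.Relation.Unary.Any using (Any; _─_)
open import Data.List.Relation.Unary.All using (All)
open import Data.List.Membership.Propositional using (_∈_)
open import Data.List.Relation.Binary.Permutation.Propositional using (_↭_)
open import Data.Maybe using (Maybe; just; nothing)
open import Data.Product using (Σ; Σ-syntax; _×_; _,_)
open import Data.Sum using (_⊎_)
open import Relation.Nullary using (¬_)
open import Relation.Binary.PropositionalEquality using (_≡_; _≢_)
open import Function.Bundles using (_⇔_)

-- First-order syntax (no equality).  Variables, function symbols and
-- predicate symbols are named by natural numbers.

data Term : Set where
  var : ℕ → Term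
  fun : ℕ → List Term → Term

-- literal: sign (true = positive), predicate symbol, arguments
data Literal : Set where
  lit : Bool → ℕ → List Term → Literal

comp : Literal → Literal
comp (lit b p ts) = lit (not b) p ts

-- clauses: finite multisets of literals, represented by lists;
-- multiset equality is _↭_, multiset membership is _∈_
Clause : Set
Clause = List Literal

data _∈v_ (x : ℕ) : Term → Set where
  here : x ∈v var x
  arg  : ∀ {f ts} → Any (x ∈v_) ts → x ∈v fun f ts

_∈vL_ : ℕ → Literal → Set
x ∈vL (lit b p ts) = Any (x ∈v_) ts

GroundL : Literal → Set
GroundL L = ∀ x → ¬ (x ∈vL L)

Subst : Set
Subst = ℕ → Term

mutual
  substT : Subst → Term → Term
  substT σ (var x)    = σ x
  substT σ (fun f ts) = fun f (substTs σ ts)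

  substTs : Subst → List Term → List Term
  substTs σ []       = []
  substTs σ (t ∷ ts) = substT σ t ∷ substTs σ ts

substL : Subst → Literal → Literal
substL σ (lit b p ts) = lit b p (substTs σ ts)

substC : Subst → Clause → Clause
substC σ C = map (substL σ) C

InDom : Subst → ℕ → Set
InDom σ x = σ x ≢ var x

MinGround : Subst → Literal → Set
MinGround σ L = GroundL (substL σ L) × (∀ x → InDom σ x ⇔ x ∈vL L)

-- σ is an mgu of L₁ and L₂, idempotent and introducing no fresh variables
IsMGU : Subst → Literal → Literal → Set
IsMGU σ L₁ L₂ =
  (substL σ L₁ ≡ substL σ L₂)
  × (∀ (θ : Subst) → substL θ L₁ ≡ substL θ L₂ →
       Σ Subst λ δ → ∀ x → θ x ≡ substT δ (σ x))
  × (∀ x → substT σ (σ x) ≡ σ x)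
  × (∀ x y → InDom σ x → y ∈v σ x → (y ∈vL L₁) ⊎ (y ∈vL L₂))

-- Trails (finite sequences of ground literals, first element = oldest)

Trail : List Literal → Set
Trail M = All GroundL M × (∀ L → L ∈ M → ¬ (comp L ∈ M))

IsFalse : List Literal → Literal → Set
IsFalse M L = comp L ∈ M

Unassigned : List Literal → Literal → Set
Unassigned M L = ¬ (L ∈ M) × ¬ (comp L ∈ M)

_⊨¬_ : List Literal → Clause → Set
M ⊨¬ C = All (IsFalse M) C

AllEqual : Clause → Set
AllEqual C = ∀ {a b} → a ∈ C → b ∈ C → a ≡ b

-- clause instance triple (C; L₁; L₂), top = true iff annotated with ⊤
record Triple : Set where
  constructor tri
  field
    cl  : Clause
    w₁  : Literal
    w₂  : Literal
    top : Bool
open Triple public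

-- annotated literal L^{C;K}; K = nothing stands for ⊤
record AnnLit : Set where
  constructor ann
  field
    alit : Literal
    acl  : Clause
    aK   : Maybe Literal
open AnnLit public

-- F is a set of annotated literals (represented as a predicate);
-- D = nothing stands for ⊤
record State : Set₁ where
  constructor st
  field
    M : List Literal
    O : List Triple
    F : AnnLit → Set
    D : Maybe Clause
open State public

-- "if possible l ∈ M, otherwise if possible l unassigned, otherwise
--  M = M' comp(l) M'' and comp(L) ∉ M'' for all L ∈ X",
-- where "possible" ranges over the candidates satisfying Cand
Pref : List Literal → (Literal → Set) → List Literal → Literal → Set
Pref M Cand X l =
  (l ∈ M)
  ⊎ ((¬ Σ Literal λ l' → Cand l' × l' ∈ M) × Unassigned M l)
  ⊎ ((¬ Σ Literal λ l' → Cand l' × l' ∈ M)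
     × (¬ Σ Literal λ l' → Cand l' × Unassigned M l')
     × Σ (List Literal) λ M₁ → Σ (List Literal) λ M₂ →
         (M ≡ M₁ ++ comp l ∷ M₂) × All (λ L → ¬ (comp L ∈ M₂)) X)

NoInstance : List Triple → Clause → Set
NoInstance O Cσ =
  ¬ (Σ Triple λ t → t ∈ O × (cl t ↭ Cσ) × (w₁ t ∈ Cσ) × (w₂ t ∈ Cσ))

-- condition (v) (shared by CreateInstance and FactorizeWatched);
-- the Lk-candidates are those admitted by condition (iii) (given as Ok)
CondV : List Literal → Subst → Literal → (Cσ : Clause) → {lj : Literal} →
        lj ∈ Cσ → (Literal → Set) → Literal → Set
CondV M σ L₂ Cσ j Ok lk =
  (¬ (comp (substL σ L₂) ∈ M) × lk ≡ substL σ L₂)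
  ⊎ (comp (substL σ L₂) ∈ M × lk ∈ Cσ
     × Pref M (λ l → l ∈ Cσ × Ok l) (Cσ ─ j) lk)

addF : (AnnLit → Set) → AnnLit → AnnLit → Set
addF F a x = F x ⊎ (x ≡ a)

data _⟹_ : State → State → Set₁ where

  createInstance :
    ∀ {M O F} {C L₁ L₂ b} (σ : Subst) {lj lk : Literal} →
    tri C L₁ L₂ b ∈ O →
    MinGround σ L₁ →
    comp (substL σ L₁) ∈ M →
    (j : lj ∈ substC σ C) →
    (¬ AllEqual (substC σ C) → lk ≢ lj) →
    Pref M (_∈ substC σ C) (substC σ C) lj →
    CondV M σ L₂ (substC σ C) j
      (λ l → ¬ AllEqual (substC σ C) → l ≢ lj) lk →
    NoInstance O (substC σ C) →
    st M O F nothing ⟹ st M (tri (substC σ C) lj lk false ∷ O) F nothing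

  updateWatched :
    ∀ {M O F} {C L₁ L₂ b} {Lj : Literal} →
    tri C L₁ L₂ b ∈ O →
    comp L₁ ∈ M →
    ¬ (L₂ ∈ M) →
    Lj ∈ C → Lj ≢ L₁ → Lj ≢ L₂ →
    (Lj ∈ M
     ⊎ ((¬ Σ Literal λ L → L ∈ C × L ≢ L₁ × L ≢ L₂ × L ∈ M) × Unassigned M Lj)) →
    ¬ (Σ Triple λ t → t ∈ O × (cl t ↭ C) × w₁ t ≡ Lj × w₂ t ≡ L₂ × top t ≡ false) →
    st M O F nothing ⟹ st M (tri C Lj L₂ false ∷ O) F nothing

  factorizeWatched :
    ∀ {M O F} {C L₁ L₂ b} (σ : Subst) {lj lk : Literal} →
    tri C L₁ L₂ b ∈ O →
    IsMGU σ L₁ L₂ →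
    (j : lj ∈ substC σ C) → lj ≢ substL σ L₁ → lj ≢ substL σ L₂ →
    lj ≢ lk →
    Pref M (λ l → l ∈ substC σ C × l ≢ substL σ L₁ × l ≢ substL σ L₂)
      (substC σ C) lj →
    CondV M σ L₂ (substC σ C) j (λ l → l ≢ lj) lk →
    NoInstance O (substC σ C) →
    st M O F nothing ⟹ st M (tri (substC σ C) lj lk false ∷ O) F nothing

  detectPropLiteral :
    ∀ {M O F} {C L₁ L₂ b} (C₀ : Clause) (n : ℕ) (M′ M″ : List Literal) (K : Literal) →
    tri C L₁ L₂ b ∈ O →
    comp L₁ ∈ M →
    C ↭ C₀ ++ replicate (suc n) L₂ →
    Unassigned M L₂ →
    M ⊨¬ C₀ →
    M ≡ M′ ++ K ∷ M″ → comp K ∈ C →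
    All (λ L → ¬ (comp L ∈ M″)) C →
    ¬ (Σ AnnLit λ h → F h × (Σ Subst λ τ → substL τ (alit h) ≡ L₂)
         × ((aK h ≡ nothing)
            ⊎ (Σ Literal λ K′ → aK h ≡ just K′ × K′ ∈ M′ ++ K ∷ []))) →
    st M O F nothing ⟹ st M O (addF F (ann L₂ C (just K))) nothing

  conflict :
    ∀ {M O F} {C L₁ L₂ b} →
    tri C L₁ L₂ b ∈ O →
    comp L₁ ∈ M → comp L₂ ∈ M → M ⊨¬ C →
    st M O F nothing ⟹ st M O F (just C)

WatchOK : Triple → Set
WatchOK t =
  Σ (Fin (length (cl t))) λ i → Σ (Fin (length (cl t))) λ k →
    (w₁ t ≡ lookup (cl t) i) × (w₂ t ≡ lookup (cl t) k) × ((i ≢ k) ⇔ (1 < length (cl t)))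

InN : List Triple → Clause → Set
InN O C = Σ Triple λ t → t ∈ O × top t ≡ true × cl t ≡ C

-- initially propagatable unit literals obtainable by factoring:
-- L^{Cτ;⊤} with C ∈ N, Cτ = L ∨ … ∨ L, and L unassigned w.r.t. M
InitProp : List Literal → List Triple → AnnLit → Set
InitProp M O a =
  Σ Clause λ C → InN O C × (Σ Subst λ τ → Σ Literal λ L →
    (a ≡ ann L (substC τ C) nothing) × (C ≢ []) × All (_≡ L) (substC τ C)
    × Unassigned M L)

StartState : State → Set
StartState s =
  Trail (M s)
  × All (λ t → top t ≡ true × WatchOK t) (O s)
  × (∀ t t′ → t ∈ O s → t′ ∈ O s → cl t ↭ cl t′ → (w₁ t ≡ w₁ t′) × (w₂ t ≡ w₂ t′))
  × (∀ a → F s a ⇔ InitProp (M s) (O s) a)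
  × (D s ≡ nothing)

module Submission where

-- The trail never changes along a run. Every clause instance in O descends from an initial
-- clause through a chain of CreateInstance/FactorizeWatched substitutions; each link is
-- proper by condition (vi) and removes a variable without introducing one, so chains are no
-- longer than the number of variables of N. A chain, recorded by literal positions, trail
-- literals and the variables fixed by each mgu, determines its instance, so finitely many
-- codes describe all triples and annotated literals a run can add. Each step other than
-- Conflict adds an object whose code did not hold before, and holding persists; by
-- pigeonhole the run is finite.

open import Defs
open import Data.Bool using (true; false)
open import Data.Bool.Properties using (not-involutive)
open import Data.Empty using (⊥-elim)
open import Data.Fin using (Fin; toℕ)
open import Data.Fin.Properties using (pigeonhole)
open import Data.List
  using (List; []; _∷_; _++_; map; length; lookup; filter; concatMap; upTo;
         cartesianProduct; cartesianProductWith)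
open import Data.List.Properties using (length-filter; length-map; ∷-injectiveˡ; ∷-injectiveʳ)
open import Data.List.Extrema.Nat using (max; xs≤max)
open import Data.List.Membership.Propositional using (_∈_)
open import Data.List.Membership.Propositional.Properties
  using (∈-++⁺ˡ; ∈-++⁺ʳ; ∈-map⁺; ∈-upTo⁺; ∈-cartesianProduct⁺; ∈-cartesianProductWith⁺;
         ∈-concatMap⁺; ∈-filter⁺; ∈-filter⁻; ∈-lookup)
open import Data.List.Relation.Unary.All as All using (All; []; _∷_)
open import Data.List.Relation.Unary.Any as Any using (Any; here; there; index; any?)
open import Data.List.Relation.Unary.Any.Properties using (lookup-index)
open import Data.List.Relation.Binary.Permutation.Propositional using (↭-refl)
open import Data.Maybe using (Maybe; just; nothing)
open import Data.Maybe.Properties using (just-injective)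
open import Data.Nat using (ℕ; zero; suc; _+_; _≤_; _<_; _≤′_; ≤′-refl; ≤′-step; z≤n; s≤s)
open import Data.Nat.Properties
  using (_≟_; ≤⇒≤′; n<1+n; m≤n⇒m≤1+n; ≤-trans; <-≤-trans; m≤m+n; +-suc; +-monoʳ-≤;
         module ≤-Reasoning)
open import Data.Product using (Σ-syntax; ∃; _×_; _,_; proj₁; proj₂)
open import Data.Sum using (inj₁; inj₂)
open import Function using (_∘_)
open import Function.Bundles using (Equivalence)
open import Relation.Nullary using (¬_; Dec; yes; no; ¬?; _×-dec_)
open import Relation.Unary using (Decidable)
open import Relation.Binary.PropositionalEquality

nth : {A : Set} → List A → ℕ → Maybe A
nth []       _       = nothing
nth (x ∷ xs) zero    = just x
nth (x ∷ xs) (suc n) = nth xs n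

position : {A : Set} {x : A} {xs : List A} → x ∈ xs → ℕ
position = toℕ ∘ index

module _ {A : Set} where

  nth-position : ∀ {x : A} {xs} (x∈xs : x ∈ xs) → nth xs (position x∈xs) ≡ just x
  nth-position (here refl)  = refl
  nth-position (there x∈xs) = nth-position x∈xs

  nth⇒∈ : ∀ {x : A} xs n → nth xs n ≡ just x → x ∈ xs
  nth⇒∈ (y ∷ xs) zero    refl = here refl
  nth⇒∈ (y ∷ xs) (suc n) eq   = there (nth⇒∈ xs n eq)

  nth⇒< : ∀ {x : A} xs n → nth xs n ≡ just x → n < length xs
  nth⇒< (y ∷ xs) zero    refl = s≤s z≤n
  nth⇒< (y ∷ xs) (suc n) eq   = s≤s (nth⇒< xs n eq)

  nth-functional : ∀ {x y : A} xs n → nth xs n ≡ just x → nth xs n ≡ just y → x ≡ y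
  nth-functional xs n p q = just-injective (trans (sym p) q)

  listsUpTo : ℕ → List A → List (List A)
  listsUpTo zero    xs = [] ∷ []
  listsUpTo (suc n) xs = [] ∷ cartesianProductWith _∷_ xs (listsUpTo n xs)

  ∈-listsUpTo : ∀ {n xs ys} → length ys ≤ n → All (_∈ xs) ys → ys ∈ listsUpTo n xs
  ∈-listsUpTo {zero}  z≤n      []         = here refl
  ∈-listsUpTo {suc n} _        []         = here refl
  ∈-listsUpTo {suc n} (s≤s ≤n) (y∈ ∷ ys∈) =
    there (∈-cartesianProductWith⁺ _∷_ y∈ (∈-listsUpTo ≤n ys∈))

  module _ {P Q : A → Set} (P? : Decidable P) (Q? : Decidable Q) (P⇒Q : ∀ {x} → P x → Q x)
           where

    length-filter-mono : ∀ xs → length (filter P? xs) ≤ length (filter Q? xs)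
    length-filter-mono [] = z≤n
    length-filter-mono (x ∷ xs) with P? x | Q? x
    ... | yes _  | yes _  = s≤s (length-filter-mono xs)
    ... | yes Px | no ¬Qx = ⊥-elim (¬Qx (P⇒Q Px))
    ... | no _   | yes _  = m≤n⇒m≤1+n (length-filter-mono xs)
    ... | no _   | no _   = length-filter-mono xs

    length-filter-strict : ∀ {x xs} → x ∈ xs → Q x → ¬ P x →
                           length (filter P? xs) < length (filter Q? xs)
    length-filter-strict {xs = y ∷ xs} x∈ Qx ¬Px with P? y | Q? y | x∈
    ... | yes Py | _      | here refl = ⊥-elim (¬Px Py)
    ... | no _   | no ¬Qy | here refl = ⊥-elim (¬Qy Qx)
    ... | no _   | yes _  | here refl = s≤s (length-filter-mono xs)
    ... | yes Py | no ¬Qy | there _   = ⊥-elim (¬Qy (P⇒Q Py))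
    ... | yes _  | yes _  | there x∈′ = s≤s (length-filter-strict x∈′ Qx ¬Px)
    ... | no _   | yes _  | there x∈′ = m≤n⇒m≤1+n (length-filter-strict x∈′ Qx ¬Px)
    ... | no _   | no _   | there x∈′ = length-filter-strict x∈′ Qx ¬Px

no-endless-fresh : {A : Set} (E : List A) (P : A → ℕ → Set) →
                   (∀ {a n} → P a n → P a (suc n)) →
                   ¬ (∀ n → Σ[ a ∈ A ] a ∈ E × P a (suc n) × ¬ P a n)
no-endless-fresh {A} E P persist fresh = repeated (pigeonhole (n<1+n (length E)) slot)
  where
  witness : ℕ → A
  witness n = proj₁ (fresh n)

  member : ∀ n → witness n ∈ E
  member n = proj₁ (proj₂ (fresh n))

  becomes-true : ∀ n → P (witness n) (suc n)
  becomes-true n = proj₁ (proj₂ (proj₂ (fresh n)))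

  was-false : ∀ n → ¬ P (witness n) n
  was-false n = proj₂ (proj₂ (proj₂ (fresh n)))

  slot : Fin (suc (length E)) → Fin (length E)
  slot i = index (member (toℕ i))

  persists : ∀ {a m n} → m ≤′ n → P a m → P a n
  persists ≤′-refl       p = p
  persists (≤′-step m≤n) p = persist (persists m≤n p)

  repeated : ¬ ∃ λ i → ∃ λ j → toℕ i < toℕ j × slot i ≡ slot j
  repeated (i , j , i<j , same-slot) =
    was-false (toℕ j)
      (subst (λ a → P a (toℕ j)) same-witness (persists (≤⇒≤′ i<j) (becomes-true (toℕ i))))
    where
    open ≡-Reasoning
    same-witness : witness (toℕ i) ≡ witness (toℕ j)
    same-witness = begin
      witness (toℕ i)    ≡⟨ lookup-index (member (toℕ i)) ⟩
      lookup E (slot i)  ≡⟨ cong (lookup E) same-slot ⟩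
      lookup E (slot j)  ≡⟨ lookup-index (member (toℕ j)) ⟨
      witness (toℕ j)    ∎

-- Terms and substitutions

var-injective : ∀ {x y} → var x ≡ var y → x ≡ y
var-injective refl = refl

_≟var_ : (t : Term) (x : ℕ) → Dec (t ≡ var x)
var y   ≟var x with y ≟ x
... | yes refl = yes refl
... | no y≢x   = no (y≢x ∘ var-injective)
fun _ _ ≟var x = no λ ()

∈v-var : ∀ {x y} → y ∈v var x → y ≡ x
∈v-var here = refl

mutual
  _∈v?_ : (x : ℕ) (t : Term) → Dec (x ∈v t)
  x ∈v? var y with x ≟ y
  ... | yes refl = yes here
  ... | no x≢y   = no (x≢y ∘ ∈v-var)
  x ∈v? fun f ts with x ∈vs? ts
  ... | yes p = yes (arg p)
  ... | no ¬p = no λ { (arg p) → ¬p p }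

  _∈vs?_ : (x : ℕ) (ts : List Term) → Dec (Any (x ∈v_) ts)
  x ∈vs? []       = no λ ()
  x ∈vs? (t ∷ ts) with x ∈v? t | x ∈vs? ts
  ... | yes p | _     = yes (here p)
  ... | no _  | yes q = yes (there q)
  ... | no ¬p | no ¬q = no λ { (here p) → ¬p p ; (there q) → ¬q q }

_∈vL?_ : (x : ℕ) (L : Literal) → Dec (x ∈vL L)
x ∈vL? lit _ _ ts = x ∈vs? ts

_∈vC_ : ℕ → Clause → Set
x ∈vC C = Any (x ∈vL_) C

_∈vC?_ : (x : ℕ) (C : Clause) → Dec (x ∈vC C)
x ∈vC? C = any? (x ∈vL?_) C

mutual
  varsT : Term → List ℕ
  varsT (var x)    = x ∷ []
  varsT (fun f ts) = varsTs ts

  varsTs : List Term → List ℕ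
  varsTs []       = []
  varsTs (t ∷ ts) = varsT t ++ varsTs ts

varsL : Literal → List ℕ
varsL (lit _ _ ts) = varsTs ts

varsC : Clause → List ℕ
varsC = concatMap varsL

mutual
  ∈v⇒∈varsT : ∀ {x} t → x ∈v t → x ∈ varsT t
  ∈v⇒∈varsT (var x)    here    = here refl
  ∈v⇒∈varsT (fun f ts) (arg p) = ∈vs⇒∈varsTs ts p

  ∈vs⇒∈varsTs : ∀ {x} ts → Any (x ∈v_) ts → x ∈ varsTs ts
  ∈vs⇒∈varsTs (t ∷ ts) (here p)  = ∈-++⁺ˡ (∈v⇒∈varsT t p)
  ∈vs⇒∈varsTs (t ∷ ts) (there p) = ∈-++⁺ʳ (varsT t) (∈vs⇒∈varsTs ts p)

∈vL⇒∈varsL : ∀ {x} L → x ∈vL L → x ∈ varsL L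
∈vL⇒∈varsL (lit _ _ ts) = ∈vs⇒∈varsTs ts

∈vC⇒∈varsC : ∀ {x} C → x ∈vC C → x ∈ varsC C
∈vC⇒∈varsC C x∈ = ∈-concatMap⁺ varsL (Any.map (λ {L} → ∈vL⇒∈varsL L) x∈)

∈vL⇒∈vC : ∀ {x L C} → L ∈ C → x ∈vL L → x ∈vC C
∈vL⇒∈vC L∈C x∈L = Any.map (λ { refl → x∈L }) L∈C

mutual
  substT-cong : ∀ σ τ t → (∀ {x} → x ∈v t → σ x ≡ τ x) → substT σ t ≡ substT τ t
  substT-cong σ τ (var x)    agree = agree here
  substT-cong σ τ (fun f ts) agree = cong (fun f) (substTs-cong σ τ ts (agree ∘ arg))

  substTs-cong : ∀ σ τ ts → (∀ {x} → Any (x ∈v_) ts → σ x ≡ τ x) →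
                 substTs σ ts ≡ substTs τ ts
  substTs-cong σ τ []       agree = refl
  substTs-cong σ τ (t ∷ ts) agree =
    cong₂ _∷_ (substT-cong σ τ t (agree ∘ here)) (substTs-cong σ τ ts (agree ∘ there))

substC-cong : ∀ σ τ C → (∀ {x} → x ∈vC C → σ x ≡ τ x) → substC σ C ≡ substC τ C
substC-cong σ τ []               agree = refl
substC-cong σ τ (lit b p ts ∷ C) agree =
  cong₂ _∷_ (cong (lit b p) (substTs-cong σ τ ts (agree ∘ here)))
            (substC-cong σ τ C (agree ∘ there))

mutual
  substT-var : ∀ t → substT var t ≡ t
  substT-var (var x)    = refl
  substT-var (fun f ts) = cong (fun f) (substTs-var ts)

  substTs-var : ∀ ts → substTs var ts ≡ ts
  substTs-var []       = refl
  substTs-var (t ∷ ts) = cong₂ _∷_ (substT-var t) (substTs-var ts)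

substL-var : ∀ L → substL var L ≡ L
substL-var (lit b p ts) = cong (lit b p) (substTs-var ts)

substC-var : ∀ C → substC var C ≡ C
substC-var []      = refl
substC-var (L ∷ C) = cong₂ _∷_ (substL-var L) (substC-var C)

mutual
  substT-agree : ∀ σ τ t → substT σ t ≡ substT τ t → ∀ {x} → x ∈v t → σ x ≡ τ x
  substT-agree σ τ (var x)    eq here    = eq
  substT-agree σ τ (fun f ts) eq (arg p) = substTs-agree σ τ ts (fun-injective eq) p
    where
    fun-injective : ∀ {f g ss us} → fun f ss ≡ fun g us → ss ≡ us
    fun-injective refl = refl

  substTs-agree : ∀ σ τ ts → substTs σ ts ≡ substTs τ ts →
                  ∀ {x} → Any (x ∈v_) ts → σ x ≡ τ x
  substTs-agree σ τ (t ∷ ts) eq (here p)  = substT-agree σ τ t (∷-injectiveˡ eq) p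
  substTs-agree σ τ (t ∷ ts) eq (there p) = substTs-agree σ τ ts (∷-injectiveʳ eq) p

substL-agree : ∀ σ τ L → substL σ L ≡ substL τ L → ∀ {x} → x ∈vL L → σ x ≡ τ x
substL-agree σ τ (lit b p ts) eq = substTs-agree σ τ ts (cong args eq)
  where args : Literal → List Term
        args (lit _ _ us) = us

substT-fixes : ∀ σ t → substT σ t ≡ t → ∀ {x} → x ∈v t → σ x ≡ var x
substT-fixes σ t eq = substT-agree σ var t (trans eq (sym (substT-var t)))

mutual
  ∈v-substT⁻ : ∀ σ t {y} → y ∈v substT σ t → ∃ λ x → x ∈v t × y ∈v σ x
  ∈v-substT⁻ σ (var x)    p       = x , here , p
  ∈v-substT⁻ σ (fun f ts) (arg p) with ∈v-substTs⁻ σ ts p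
  ... | x , x∈ , y∈ = x , arg x∈ , y∈

  ∈v-substTs⁻ : ∀ σ ts {y} → Any (y ∈v_) (substTs σ ts) →
                ∃ λ x → Any (x ∈v_) ts × y ∈v σ x
  ∈v-substTs⁻ σ (t ∷ ts) (here p) with ∈v-substT⁻ σ t p
  ... | x , x∈ , y∈ = x , here x∈ , y∈
  ∈v-substTs⁻ σ (t ∷ ts) (there p) with ∈v-substTs⁻ σ ts p
  ... | x , x∈ , y∈ = x , there x∈ , y∈

∈v-substC⁻ : ∀ σ C {y} → y ∈vC substC σ C → ∃ λ x → x ∈vC C × y ∈v σ x
∈v-substC⁻ σ (lit b p ts ∷ C) (here q) with ∈v-substTs⁻ σ ts q
... | x , x∈ , y∈ = x , here x∈ , y∈
∈v-substC⁻ σ (L ∷ C) (there q) with ∈v-substC⁻ σ C q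
... | x , x∈ , y∈ = x , there x∈ , y∈

mutual
  ∈v-substT⁺ : ∀ σ t {x y} → x ∈v t → y ∈v σ x → y ∈v substT σ t
  ∈v-substT⁺ σ (var x)    here    q = q
  ∈v-substT⁺ σ (fun f ts) (arg p) q = arg (∈v-substTs⁺ σ ts p q)

  ∈v-substTs⁺ : ∀ σ ts {x y} → Any (x ∈v_) ts → y ∈v σ x → Any (y ∈v_) (substTs σ ts)
  ∈v-substTs⁺ σ (t ∷ ts) (here p)  q = here (∈v-substT⁺ σ t p q)
  ∈v-substTs⁺ σ (t ∷ ts) (there p) q = there (∈v-substTs⁺ σ ts p q)

∈v-substL⁺ : ∀ σ L {x y} → x ∈vL L → y ∈v σ x → y ∈vL substL σ L
∈v-substL⁺ σ (lit b p ts) = ∈v-substTs⁺ σ ts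

∈v-≡var : ∀ {t x y} → t ≡ var x → y ∈v t → y ≡ x
∈v-≡var refl = ∈v-var

substC-fixed : ∀ σ C → (∀ {x} → x ∈vC C → σ x ≡ var x) → substC σ C ≡ C
substC-fixed σ C fixed = trans (substC-cong σ var C fixed) (substC-var C)

moved-variable : ∀ (U : List ℕ) σ C → (∀ {x} → x ∈vC C → x ∈ U) → substC σ C ≢ C →
                 ∃ λ x → x ∈vC C × InDom σ x
moved-variable U σ C ⊆U proper with any? (λ x → x ∈vC? C ×-dec ¬? (σ x ≟var x)) U
... | yes moved = Any.satisfied moved
... | no ¬moved = ⊥-elim (proper (substC-fixed σ C fixed))
  where
  fixed : ∀ {x} → x ∈vC C → σ x ≡ var x
  fixed {x} x∈C with σ x ≟var x
  ... | yes σx≡x = σx≡x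
  ... | no σx≢x  = ⊥-elim (¬moved (Any.map (λ { refl → x∈C , σx≢x }) (⊆U x∈C)))

record VarReducing (σ : Subst) (C : Clause) : Set where
  field
    fixes-range : ∀ {x y} → y ∈v σ x → σ y ≡ var y
    keeps-vars  : ∀ {x y} → x ∈vC C → y ∈v σ x → y ∈vC C

  vars-⊆ : ∀ {y} → y ∈vC substC σ C → y ∈vC C
  vars-⊆ y∈ with ∈v-substC⁻ σ C y∈
  ... | _ , x∈C , y∈σx = keeps-vars x∈C y∈σx

  removes : ∀ {x} → InDom σ x → ¬ x ∈vC substC σ C
  removes σx≢x x∈ with ∈v-substC⁻ σ C x∈
  ... | _ , _ , x∈σx′ = σx≢x (fixes-range x∈σx′)

minGround-ground : ∀ {σ L x y} → MinGround σ L → InDom σ x → ¬ y ∈v σ x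
minGround-ground {σ} {L} {x} (ground , dom) σx≢x y∈ =
  ground _ (∈v-substL⁺ σ L (Equivalence.to (dom x) σx≢x) y∈)

minGround-varReducing : ∀ {σ L} C → MinGround σ L → VarReducing σ C
minGround-varReducing {σ} C mg = record { fixes-range = fixes-range ; keeps-vars = keeps-vars }
  where
  fixes-range : ∀ {x y} → y ∈v σ x → σ y ≡ var y
  fixes-range {x} y∈ with σ x ≟var x
  ... | yes σx≡x = subst (λ z → σ z ≡ var z) (sym (∈v-≡var σx≡x y∈)) σx≡x
  ... | no σx≢x  = ⊥-elim (minGround-ground mg σx≢x y∈)

  keeps-vars : ∀ {x y} → x ∈vC C → y ∈v σ x → y ∈vC C
  keeps-vars {x} x∈C y∈ with σ x ≟var x
  ... | yes σx≡x = subst (_∈vC C) (sym (∈v-≡var σx≡x y∈)) x∈C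
  ... | no σx≢x  = ⊥-elim (minGround-ground mg σx≢x y∈)

minGround-unique : ∀ {σ σ′ L} → MinGround σ L → MinGround σ′ L →
                   substL σ L ≡ substL σ′ L → ∀ x → σ x ≡ σ′ x
minGround-unique {σ} {σ′} {L} (_ , dom) (_ , dom′) eq x with σ x ≟var x | σ′ x ≟var x
... | yes σx≡x | yes σ′x≡x = trans σx≡x (sym σ′x≡x)
... | no σx≢x  | _         = substL-agree σ σ′ L eq (Equivalence.to (dom x) σx≢x)
... | yes _    | no σ′x≢x  = substL-agree σ σ′ L eq (Equivalence.to (dom′ x) σ′x≢x)

mgu-varReducing : ∀ {σ L₁ L₂ C} → L₁ ∈ C → L₂ ∈ C → IsMGU σ L₁ L₂ → VarReducing σ C
mgu-varReducing {σ} {C = C} L₁∈C L₂∈C (_ , _ , idempotent , range) =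
  record { fixes-range = fixes-range ; keeps-vars = keeps-vars }
  where
  fixes-range : ∀ {x y} → y ∈v σ x → σ y ≡ var y
  fixes-range {x} = substT-fixes σ (σ x) (idempotent x)

  keeps-vars : ∀ {x y} → x ∈vC C → y ∈v σ x → y ∈vC C
  keeps-vars {x} {y} x∈C y∈ with σ x ≟var x
  ... | yes σx≡x = subst (_∈vC C) (sym (∈v-≡var σx≡x y∈)) x∈C
  ... | no σx≢x with range x y σx≢x y∈
  ...   | inj₁ y∈L₁ = ∈vL⇒∈vC L₁∈C y∈L₁
  ...   | inj₂ y∈L₂ = ∈vL⇒∈vC L₂∈C y∈L₂

mgu-agree : ∀ {σ σ′ L₁ L₂} → IsMGU σ L₁ L₂ → IsMGU σ′ L₁ L₂ →
            ∀ {x} → (∀ {y} → y ∈v σ x → σ′ y ≡ var y) → σ′ x ≡ σ x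
mgu-agree {σ} {σ′} (_ , general , idempotent , _) (unifies′ , _) {x} fixed′ = begin
  σ′ x              ≡⟨ factor x ⟩
  substT δ (σ x)    ≡⟨ substT-cong δ var (σ x) δ-fixes ⟩
  substT var (σ x)  ≡⟨ substT-var (σ x) ⟩
  σ x               ∎
  where
  open ≡-Reasoning
  δ = proj₁ (general σ′ unifies′)
  factor = proj₂ (general σ′ unifies′)

  δ-fixes : ∀ {y} → y ∈v σ x → δ y ≡ var y
  δ-fixes {y} y∈ = begin
    δ y             ≡⟨ cong (substT δ) (substT-fixes σ (σ x) (idempotent x) y∈) ⟨
    substT δ (σ y)  ≡⟨ factor y ⟨
    σ′ y            ≡⟨ fixed′ y∈ ⟩
    var y           ∎

comp-injective : ∀ {L L′} → comp L ≡ comp L′ → L ≡ L′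
comp-injective {lit b p ts} {lit b′ p′ ts′} eq =
  subst₂ (λ c c′ → lit c p ts ≡ lit c′ p′ ts′) (not-involutive b) (not-involutive b′)
         (cong comp eq)

-- Runs of TWFO

⟹-O : ∀ {s s′} → s ⟹ s′ → ∀ {t} → t ∈ O s → t ∈ O s′
⟹-O (createInstance _ _ _ _ _ _ _ _ _)                 = there
⟹-O (updateWatched _ _ _ _ _ _ _ _)                    = there
⟹-O (factorizeWatched _ _ _ _ _ _ _ _ _ _)             = there
⟹-O (detectPropLiteral _ _ _ _ _ _ _ _ _ _ _ _ _ _)    = λ t∈ → t∈
⟹-O (conflict _ _ _ _)                                 = λ t∈ → t∈

⟹-F : ∀ {s s′} → s ⟹ s′ → ∀ {a} → F s a → F s′ a
⟹-F (createInstance _ _ _ _ _ _ _ _ _)                 = λ a∈ → a∈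
⟹-F (updateWatched _ _ _ _ _ _ _ _)                    = λ a∈ → a∈
⟹-F (factorizeWatched _ _ _ _ _ _ _ _ _ _)             = λ a∈ → a∈
⟹-F (detectPropLiteral _ _ _ _ _ _ _ _ _ _ _ _ _ _)    = inj₁
⟹-F (conflict _ _ _ _)                                 = λ a∈ → a∈

⟹-conflict-free : ∀ {s s′} → s ⟹ s′ → D s ≡ nothing
⟹-conflict-free (createInstance _ _ _ _ _ _ _ _ _)              = refl
⟹-conflict-free (updateWatched _ _ _ _ _ _ _ _)                 = refl
⟹-conflict-free (factorizeWatched _ _ _ _ _ _ _ _ _ _)          = refl
⟹-conflict-free (detectPropLiteral _ _ _ _ _ _ _ _ _ _ _ _ _ _) = refl
⟹-conflict-free (conflict _ _ _ _)                              = refl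

noInstance⇒∉ : ∀ {O C L₁ L₂ b} → NoInstance O C → L₁ ∈ C → L₂ ∈ C → ¬ tri C L₁ L₂ b ∈ O
noInstance⇒∉ noInstance L₁∈ L₂∈ t∈ = noInstance (_ , t∈ , ↭-refl , L₁∈ , L₂∈)

noInstance⇒proper : ∀ {O σ C L₁ L₂ b} → NoInstance O (substC σ C) →
                    tri C L₁ L₂ b ∈ O → L₁ ∈ C → L₂ ∈ C → substC σ C ≢ C
noInstance⇒proper {O} noInstance t∈ L₁∈ L₂∈ eq =
  noInstance⇒∉ (subst (NoInstance O) eq noInstance) L₁∈ L₂∈ t∈

condV-∈ : ∀ {M σ L₂ C lj lk Ok} {j : lj ∈ substC σ C} →
          L₂ ∈ C → CondV M σ L₂ (substC σ C) j Ok lk → lk ∈ substC σ C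
condV-∈ {σ = σ} L₂∈ (inj₁ (_ , refl))   = ∈-map⁺ (substL σ) L₂∈
condV-∈         _   (inj₂ (_ , lk∈ , _)) = lk∈

-- A step records what determines the new instance Cσ: positions in C of the literals
-- involved, the trail literal comp (Lσ) fixing a minimal grounding σ, and, since mgus are
-- unique only up to renaming, the variables that the chosen mgu fixes.
data Step : Set where
  instantiate : (i : ℕ) (K : Literal) → Step
  factorize   : (i j : ℕ) (fixed : List ℕ) → Step

data Code : Set where
  watch     : (r : ℕ) (ps : List Step) (i j : ℕ) → Code
  propagate : (r : ℕ) (ps : List Step) (i : ℕ) (K : Literal) → Code

module Run (O₀ : List Triple) (M₀ : List Literal) where

  U : List ℕ
  U = concatMap (varsC ∘ cl) O₀

  varCount : Clause → ℕ
  varCount C = length (filter (_∈vC? C) U)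

  varCount-< : ∀ {σ C} → VarReducing σ C → (∀ {x} → x ∈vC C → x ∈ U) → substC σ C ≢ C →
               varCount (substC σ C) < varCount C
  varCount-< {σ} {C} reducing ⊆U proper with moved-variable U σ C ⊆U proper
  ... | x , x∈C , σx≢x =
    length-filter-strict (_∈vC? substC σ C) (_∈vC? C) vars-⊆ (⊆U x∈C) x∈C (removes σx≢x)
    where open VarReducing reducing

  fixedVars : Subst → List ℕ
  fixedVars σ = filter (λ u → σ u ≟var u) U

  fixedVars-≡ : ∀ {σ σ′ u} → fixedVars σ ≡ fixedVars σ′ → u ∈ U →
                σ u ≡ var u → σ′ u ≡ var u
  fixedVars-≡ {σ} {σ′} eq u∈U σu≡u =
    proj₂ (∈-filter⁻ (λ u → σ′ u ≟var u) {xs = U}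
            (subst (_ ∈_) eq (∈-filter⁺ (λ u → σ u ≟var u) u∈U σu≡u)))

  data Realises : Step → Subst → Clause → Set where
    instantiated : ∀ {σ C i L K} → nth C i ≡ just L → MinGround σ L →
                   comp (substL σ L) ≡ K → K ∈ M₀ → Realises (instantiate i K) σ C
    factorized   : ∀ {σ C i j L₁ L₂ p} → nth C i ≡ just L₁ → nth C j ≡ just L₂ →
                   IsMGU σ L₁ L₂ → fixedVars σ ≡ p → Realises (factorize i j p) σ C

  -- r indexes the initial clause; the most recent step comes first.
  data Derived : ℕ → List Step → Clause → Set where
    initial : ∀ {r t} → nth O₀ r ≡ just t → Derived r [] (cl t)
    step    : ∀ {r ps C s σ} → Derived r ps C → Realises s σ C → substC σ C ≢ C →
              Derived r (s ∷ ps) (substC σ C)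

  realises-varReducing : ∀ {s σ C} → Realises s σ C → VarReducing σ C
  realises-varReducing {C = C} (instantiated _ ground _ _) = minGround-varReducing C ground
  realises-varReducing {C = C} (factorized e₁ e₂ mgu _)   =
    mgu-varReducing (nth⇒∈ C _ e₁) (nth⇒∈ C _ e₂) mgu

  realises-unique : ∀ {s σ σ′ C} → (∀ {x} → x ∈vC C → x ∈ U) →
                    Realises s σ C → Realises s σ′ C → substC σ C ≡ substC σ′ C
  realises-unique {σ = σ} {σ′} {C} _ (instantiated e ground refl _)
                  (instantiated e′ ground′ eq _)
    with nth-functional C _ e e′
  ... | refl =
    substC-cong σ σ′ C λ {x} _ → minGround-unique ground ground′ (comp-injective (sym eq)) x
  realises-unique {σ = σ} {σ′} {C} ⊆U real@(factorized e₁ e₂ mgu refl)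
                  (factorized e₁′ e₂′ mgu′ eq)
    with nth-functional C _ e₁ e₁′ | nth-functional C _ e₂ e₂′
  ... | refl | refl = substC-cong σ σ′ C λ x∈C → sym (mgu-agree mgu mgu′ λ y∈ →
          fixedVars-≡ (sym eq) (⊆U (keeps-vars x∈C y∈)) (fixes-range y∈))
    where open VarReducing (realises-varReducing real)

  derived-vars : ∀ {r ps C} → Derived r ps C → ∀ {x} → x ∈vC C → x ∈ U
  derived-vars (initial {t = t} e) x∈ =
    ∈-concatMap⁺ (varsC ∘ cl) (Any.map (λ { refl → ∈vC⇒∈varsC (cl t) x∈ }) (nth⇒∈ O₀ _ e))
  derived-vars (step d real _) x∈ =
    derived-vars d (VarReducing.vars-⊆ (realises-varReducing real) x∈)

  derived-unique : ∀ {r ps C C′} → Derived r ps C → Derived r ps C′ → C ≡ C′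
  derived-unique (initial e)     (initial e′)      = cong cl (nth-functional O₀ _ e e′)
  derived-unique (step d real _) (step d′ real′ _) with derived-unique d d′
  ... | refl = realises-unique (derived-vars d) real real′

  derived-depth : ∀ {r ps C} → Derived r ps C → length ps + varCount C ≤ length U
  derived-depth {C = C} (initial _) = length-filter (_∈vC? C) U
  derived-depth (step {ps = ps} {C} {σ = σ} d real proper) = begin
    suc (length ps + varCount (substC σ C))  ≡⟨ +-suc (length ps) _ ⟨
    length ps + suc (varCount (substC σ C))  ≤⟨ +-monoʳ-≤ (length ps) shrinks ⟩
    length ps + varCount C                   ≤⟨ derived-depth d ⟩
    length U                                 ∎
    where
    open ≤-Reasoning
    shrinks = varCount-< (realises-varReducing real) (derived-vars d) proper

  Lmax : ℕ
  Lmax = max 0 (map (length ∘ cl) O₀)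

  derived-length : ∀ {r ps C} → Derived r ps C → length C ≤ Lmax
  derived-length (initial e) =
    All.lookup (xs≤max 0 (map (length ∘ cl) O₀)) (∈-map⁺ (length ∘ cl) (nth⇒∈ O₀ _ e))
  derived-length (step {C = C} {σ = σ} d _ _) =
    subst (_≤ Lmax) (sym (length-map (substL σ) C)) (derived-length d)

  steps : List Step
  steps = cartesianProductWith instantiate (upTo Lmax) M₀
       ++ cartesianProductWith (λ (i , j) → factorize i j)
            (cartesianProduct (upTo Lmax) (upTo Lmax)) (listsUpTo (length U) U)

  position-∈ : ∀ {i L} (C : Clause) → length C ≤ Lmax → nth C i ≡ just L → i ∈ upTo Lmax
  position-∈ C ≤Lmax e = ∈-upTo⁺ (<-≤-trans (nth⇒< C _ e) ≤Lmax)

  realises-∈ : ∀ {s σ C} → length C ≤ Lmax → Realises s σ C → s ∈ steps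
  realises-∈ {C = C} ≤Lmax (instantiated e _ _ K∈) =
    ∈-++⁺ˡ (∈-cartesianProductWith⁺ instantiate (position-∈ C ≤Lmax e) K∈)
  realises-∈ {C = C} ≤Lmax (factorized {σ = σ} e₁ e₂ _ refl) =
    ∈-++⁺ʳ _ (∈-cartesianProductWith⁺ _
      (∈-cartesianProduct⁺ (position-∈ C ≤Lmax e₁) (position-∈ C ≤Lmax e₂))
      (∈-listsUpTo (length-filter _ U)
        (All.tabulate (proj₁ ∘ ∈-filter⁻ (λ u → σ u ≟var u) {xs = U}))))

  derived-steps : ∀ {r ps C} → Derived r ps C → All (_∈ steps) ps
  derived-steps (initial _)     = []
  derived-steps (step d real _) = realises-∈ (derived-length d) real ∷ derived-steps d

  origins : List (ℕ × List Step)
  origins = cartesianProduct (upTo (length O₀)) (listsUpTo (length U) steps)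

  derived-origin : ∀ {r ps C} → Derived r ps C → (r , ps) ∈ origins
  derived-origin d =
    ∈-cartesianProduct⁺ (∈-upTo⁺ (root d))
      (∈-listsUpTo (≤-trans (m≤m+n _ _) (derived-depth d)) (derived-steps d))
    where
    root : ∀ {r ps C} → Derived r ps C → r < length O₀
    root (initial e)  = nth⇒< O₀ _ e
    root (step d _ _) = root d

  codes : List Code
  codes = cartesianProductWith (λ (r , ps) (i , j) → watch r ps i j)
            origins (cartesianProduct (upTo Lmax) (upTo Lmax))
       ++ cartesianProductWith (λ (r , ps) (i , K) → propagate r ps i K)
            origins (cartesianProduct (upTo Lmax) M₀)

  Holds : Code → State → Set
  Holds (watch r ps i j) s =
    Σ[ C ∈ Clause ] Σ[ L₁ ∈ Literal ] Σ[ L₂ ∈ Literal ]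
      Derived r ps C × nth C i ≡ just L₁ × nth C j ≡ just L₂ × tri C L₁ L₂ false ∈ O s
  Holds (propagate r ps i K) s =
    Σ[ C ∈ Clause ] Σ[ L ∈ Literal ] Derived r ps C × nth C i ≡ just L × F s (ann L C (just K))

  holds-mono : ∀ c {s s′} → s ⟹ s′ → Holds c s → Holds c s′
  holds-mono (watch _ _ _ _) s⟹s′ (C , L₁ , L₂ , d , e₁ , e₂ , t∈) =
    C , L₁ , L₂ , d , e₁ , e₂ , ⟹-O s⟹s′ t∈
  holds-mono (propagate _ _ _ _) s⟹s′ (C , L , d , e , a∈) =
    C , L , d , e , ⟹-F s⟹s′ a∈

  FreshCode : State → State → Set
  FreshCode s s′ = Σ[ c ∈ Code ] c ∈ codes × Holds c s′ × ¬ Holds c s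

  WellWatched : Triple → Set
  WellWatched t =
    (Σ[ r ∈ ℕ ] Σ[ ps ∈ List Step ] Derived r ps (cl t)) × w₁ t ∈ cl t × w₂ t ∈ cl t

  Invariant : State → Set
  Invariant s = M s ≡ M₀ × All WellWatched (O s)

  initial-wellWatched : All (λ t → top t ≡ true × WatchOK t) O₀ → All WellWatched O₀
  initial-wellWatched ok =
    All.tabulate λ t∈ → (position t∈ , [] , initial (nth-position t∈)) , watched (All.lookup ok t∈)
    where
    watched : ∀ {t} → top t ≡ true × WatchOK t → w₁ t ∈ cl t × w₂ t ∈ cl t
    watched {t} (_ , i , k , w₁≡ , w₂≡ , _) =
      subst (_∈ cl t) (sym w₁≡) (∈-lookup i) , subst (_∈ cl t) (sym w₂≡) (∈-lookup k)

  child-wellWatched : ∀ {O C L₁ L₂ b s σ lj lk} →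
                      tri C L₁ L₂ b ∈ O → WellWatched (tri C L₁ L₂ b) →
                      Realises s σ C → NoInstance O (substC σ C) →
                      lj ∈ substC σ C → lk ∈ substC σ C →
                      WellWatched (tri (substC σ C) lj lk false)
  child-wellWatched t∈ ((r , ps , d) , L₁∈ , L₂∈) real noInstance lj∈ lk∈ =
    (r , _ ∷ ps , step d real (noInstance⇒proper noInstance t∈ L₁∈ L₂∈)) , lj∈ , lk∈

  add-watched : ∀ {M O F C L₁ L₂} →
                WellWatched (tri C L₁ L₂ false) → ¬ tri C L₁ L₂ false ∈ O →
                FreshCode (st M O F nothing) (st M (tri C L₁ L₂ false ∷ O) F nothing)
  add-watched {M} {O} {F} {C} ((r , ps , d) , L₁∈ , L₂∈) new =
    watch r ps (position L₁∈) (position L₂∈) ,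
    ∈-++⁺ˡ (∈-cartesianProductWith⁺ _ (derived-origin d)
             (∈-cartesianProduct⁺ (position-∈ C (derived-length d) (nth-position L₁∈))
                                  (position-∈ C (derived-length d) (nth-position L₂∈)))) ,
    (C , _ , _ , d , nth-position L₁∈ , nth-position L₂∈ , here refl) ,
    old
    where
    old : ¬ Holds (watch r ps (position L₁∈) (position L₂∈)) (st M O F nothing)
    old (_ , _ , _ , d′ , e₁ , e₂ , t∈) with derived-unique d′ d
    ... | refl
      with nth-functional C _ e₁ (nth-position L₁∈) | nth-functional C _ e₂ (nth-position L₂∈)
    ... | refl | refl = new t∈

  add-propagated : ∀ {M O F C L K r ps} →
                   Derived r ps C → L ∈ C → K ∈ M₀ → ¬ F (ann L C (just K)) →
                   FreshCode (st M O F nothing) (st M O (addF F (ann L C (just K))) nothing)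
  add-propagated {M} {O} {F} {C} {L} {K} {r} {ps} d L∈ K∈M₀ new =
    propagate r ps (position L∈) K ,
    ∈-++⁺ʳ _ (∈-cartesianProductWith⁺ _ (derived-origin d)
               (∈-cartesianProduct⁺ (position-∈ C (derived-length d) (nth-position L∈)) K∈M₀)) ,
    (C , L , d , nth-position L∈ , inj₂ refl) ,
    old
    where
    old : ¬ Holds (propagate r ps (position L∈) K) (st M O F nothing)
    old (_ , _ , d′ , e , annotated) with derived-unique d′ d
    ... | refl with nth-functional C _ e (nth-position L∈)
    ... | refl = new annotated

  step-progress : ∀ {s s′} → Invariant s → s ⟹ s′ →
                  Invariant s′ × (D s′ ≡ nothing → FreshCode s s′)
  step-progress (M≡ , wellWatched) (createInstance σ t∈ ground comp∈M lj∈ _ _ condV noInstance)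
    with All.lookup wellWatched t∈
  ... | parent@(_ , L₁∈ , L₂∈) =
    (M≡ , child ∷ wellWatched) , λ _ → add-watched child (noInstance⇒∉ noInstance lj∈ lk∈)
    where
    lk∈ = condV-∈ L₂∈ condV
    child = child-wellWatched t∈ parent
              (instantiated (nth-position L₁∈) ground refl (subst (_ ∈_) M≡ comp∈M))
              noInstance lj∈ lk∈
  step-progress (M≡ , wellWatched) (factorizeWatched σ t∈ mgu lj∈ _ _ _ _ condV noInstance)
    with All.lookup wellWatched t∈
  ... | parent@(_ , L₁∈ , L₂∈) =
    (M≡ , child ∷ wellWatched) , λ _ → add-watched child (noInstance⇒∉ noInstance lj∈ lk∈)
    where
    lk∈ = condV-∈ L₂∈ condV
    child = child-wellWatched t∈ parent
              (factorized (nth-position L₁∈) (nth-position L₂∈) mgu refl) noInstance lj∈ lk∈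
  step-progress (M≡ , wellWatched) (updateWatched t∈ _ _ Lj∈ _ _ _ notYetWatched)
    with All.lookup wellWatched t∈
  ... | (derivation , _ , L₂∈) =
    (M≡ , child ∷ wellWatched) ,
    λ _ → add-watched child λ t′∈ → notYetWatched (_ , t′∈ , ↭-refl , refl , refl , refl)
    where child = derivation , Lj∈ , L₂∈
  step-progress (M≡ , wellWatched)
                (detectPropLiteral {L₂ = L₂} _ _ M′ _ K t∈ _ _ _ _ M≡M′KM″ _ _ noEarlier)
    with All.lookup wellWatched t∈
  ... | ((_ , _ , d) , _ , L₂∈) =
    (M≡ , wellWatched) , λ _ → add-propagated d L₂∈ K∈M₀ λ annotated →
      noEarlier (_ , annotated , (var , substL-var L₂) , inj₂ (K , refl , ∈-++⁺ʳ M′ (here refl)))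
    where
    K∈M₀ : K ∈ M₀
    K∈M₀ = subst (K ∈_) (trans (sym M≡M′KM″) M≡) (∈-++⁺ʳ M′ (here refl))
  step-progress invariant (conflict _ _ _ _) = invariant , λ ()

lemma2 : (f : ℕ → State) → StartState (f 0) → ¬ (∀ n → f n ⟹ f (suc n))
lemma2 f (_ , initial-triples , _ , _ , _) run =
  no-endless-fresh codes (λ c n → Holds c (f n)) (λ {c} {n} → holds-mono c (run n)) fresh
  where
  open Run (O (f 0)) (M (f 0))

  invariant : ∀ n → Invariant (f n)
  invariant zero    = refl , initial-wellWatched initial-triples
  invariant (suc n) = proj₁ (step-progress (invariant n) (run n))

  -- A Conflict step has no successor, so in an infinite run no step is a Conflict.
  fresh : ∀ n → FreshCode (f n) (f (suc n))
  fresh n = proj₂ (step-progress (invariant n) (run n)) (⟹-conflict-free (run (suc n)))
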